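{- Let $\Delta$ be a simplicial complex and $i$ a positive integer. Then $\Delta$ is $i$-banner if and only if its suspension $\Sigma\Delta$ is $(i+1)$-banner.
   Context: A simplicial complex $\Delta$ is a family of subsets of a vertex set closed under taking subsets and containing all singletons. The suspension $\Sigma\Delta$ is the join of $\Delta$ with a $0$-dimensional sphere $\{\emptyset,\{u\},\{u'\}\}$ on two new vertices, i.e. $\Sigma\Delta=\{F, F\cup\{u\},F\cup\{u'\}: F\in\Delta\}$. A clique of $\Delta$ is a set $T$ of vertices every two of which form an edge; it is critical if $T\setminus\{v\}$ is a face for some $v\in T$. For a positive integer $m$, $\Delta$ is $m$-banner if every critical clique of size at least $m+1$ is a face of $\Delta$. -}

module Defs where

open import Data.Nat using (ℕ; suc; _≤_; _+_)
open import Data.Bool using (Bool; true; false)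
open import Data.Fin using (Fin)
open import Data.Fin.Subset using (Subset; _∈_; _⊆_; ⁅_⁆; _∪_; _-_; ∣_∣)
open import Data.Vec using (_∷_)
open import Data.Product using (Σ; _×_; ∃)
open import Relation.Nullary using (¬_)
open import Relation.Binary.PropositionalEquality using (_≡_)

Family : ℕ → Set₁
Family n = Subset n → Set

record IsSimplicialComplex {n : ℕ} (Δ : Family n) : Set where
  field
    down-closed : ∀ {F G : Subset n} → Δ F → G ⊆ F → Δ G
    singletons  : ∀ (v : Fin n) → Δ ⁅ v ⁆

IsClique : {n : ℕ} → Family n → Subset n → Set
IsClique Δ T = ∀ v w → v ∈ T → w ∈ T → ¬ (v ≡ w) → Δ (⁅ v ⁆ ∪ ⁅ w ⁆)

IsCritical : {n : ℕ} → Family n → Subset n → Set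
IsCritical Δ T = ∃ λ v → v ∈ T × Δ (T - v)

IsBanner : {n : ℕ} → ℕ → Family n → Set
IsBanner m Δ = ∀ T → IsClique Δ T → IsCritical Δ T → suc m ≤ ∣ T ∣ → Δ T

-- Suspension: vertex set Fin (2+n); the two new vertices u, u' are the first
-- two positions (Fin.zero, Fin.suc Fin.zero), old vertex v is suc (suc v).
-- Faces: F, F ∪ {u}, F ∪ {u'} for F ∈ Δ, i.e. old part in Δ and not both u, u'.
Suspension : {n : ℕ} → Family n → Family (suc (suc n))
Suspension Δ (bu ∷ bu' ∷ F) = Δ F × ¬ (bu ≡ true × bu' ≡ true)

module Submission where

-- (⇒) A critical clique T of ΣΔ with at least i+2 vertices has at most one
-- apex, so its old part F is a clique with at least i+1 vertices which is a
-- face or critical; by the i-banner property F ∈ Δ, hence T ∈ ΣΔ.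
-- (⇐) A critical clique F of Δ with at least i+1 vertices gives the critical
-- clique F ∪ {u} of ΣΔ with at least i+2 vertices; it is a face, so F ∈ Δ.

open import Defs
open import Data.Nat using (ℕ; suc; _≤_; s≤s)
open import Data.Nat.Properties using (≤-refl; ≤-trans; n≤1+n)
open import Data.Product using (_×_; _,_; proj₁; proj₂)
open import Data.Sum using (_⊎_; inj₁; inj₂; [_,_])
open import Data.Bool using (Bool; true; false)
open import Data.Fin using (zero; suc)
open import Data.Fin.Subset using (Subset; ⁅_⁆; ∣_∣)
open import Data.Fin.Subset.Properties using (∪-identityˡ; ∪-identityʳ; p─⊥≡p)
open import Data.Fin.Properties using (suc-injective)
open import Data.Vec using (_∷_)
open import Data.Vec.Base using (here; there)
open import Data.Empty using (⊥-elim)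
open import Relation.Nullary using (¬_)
open import Relation.Binary.PropositionalEquality using (_≡_; refl; sym; cong; subst)

AtMostOneApex : Bool → Bool → Set
AtMostOneApex bu bu' = ¬ (bu ≡ true × bu' ≡ true)

size-at-most-one-apex : ∀ {n} bu bu' (F : Subset n) → AtMostOneApex bu bu' →
  ∣ bu ∷ bu' ∷ F ∣ ≤ suc ∣ F ∣
size-at-most-one-apex true  true  F both = ⊥-elim (both (refl , refl))
size-at-most-one-apex true  false F _    = ≤-refl
size-at-most-one-apex false true  F _    = ≤-refl
size-at-most-one-apex false false F _    = n≤1+n ∣ F ∣

module _ {n : ℕ} (Δ : Family n) where

  -- The two apices are not joined by an edge, so a clique contains at most one.
  clique-at-most-one-apex : ∀ bu bu' F → IsClique (Suspension Δ) (bu ∷ bu' ∷ F) →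
    AtMostOneApex bu bu'
  clique-at-most-one-apex true true F clique (refl , refl) =
    proj₂ (clique zero (suc zero) here (there here) (λ ())) (refl , refl)

  clique-restrict : ∀ bu bu' F → IsClique (Suspension Δ) (bu ∷ bu' ∷ F) → IsClique Δ F
  clique-restrict bu bu' F clique v w v∈F w∈F v≢w =
    proj₁ (clique (suc (suc v)) (suc (suc w)) (there (there v∈F)) (there (there w∈F))
                  (λ e → v≢w (suc-injective (suc-injective e))))

  -- If removing a vertex of  bu ∷ bu' ∷ F  leaves a face of ΣΔ, then either the
  -- vertex was an apex and F itself is a face, or it was old and F is critical.
  critical-restrict : ∀ bu bu' F → IsCritical (Suspension Δ) (bu ∷ bu' ∷ F) →
    Δ F ⊎ IsCritical Δ F
  critical-restrict bu bu' F (zero , _ , face) = inj₁ (subst Δ (p─⊥≡p F) (proj₁ face))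
  critical-restrict bu bu' F (suc zero , _ , face) = inj₁ (subst Δ (p─⊥≡p F) (proj₁ face))
  critical-restrict bu bu' F (suc (suc v) , there (there v∈F) , face) =
    inj₂ (v , v∈F , proj₁ face)

  cone-critical : ∀ F → IsCritical Δ F → IsCritical (Suspension Δ) (true ∷ false ∷ F)
  cone-critical F (v , v∈F , face) = suc (suc v) , there (there v∈F) , face , λ { (_ , ()) }

  -- The cone over a clique of Δ is a clique of ΣΔ: edges to the apex u come
  -- from the singleton faces of Δ.
  cone-clique : (∀ v → Δ ⁅ v ⁆) → ∀ F → IsClique Δ F →
    IsClique (Suspension Δ) (true ∷ false ∷ F)
  cone-clique singleton F clique zero zero _ _ u≢u = ⊥-elim (u≢u refl)
  cone-clique singleton F clique zero (suc (suc w)) _ _ _ =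
    subst Δ (sym (∪-identityˡ ⁅ w ⁆)) (singleton w) , λ { (_ , ()) }
  cone-clique singleton F clique (suc (suc v)) zero _ _ _ =
    subst Δ (sym (∪-identityʳ ⁅ v ⁆)) (singleton v) , λ { (_ , ()) }
  cone-clique singleton F clique (suc (suc v)) (suc (suc w))
              (there (there v∈F)) (there (there w∈F)) v≢w =
    clique v w v∈F w∈F (λ e → v≢w (cong (λ x → suc (suc x)) e)) , λ { (() , _) }
  cone-clique singleton F clique zero (suc zero) _ (there ()) _
  cone-clique singleton F clique (suc zero) _ (there ()) _ _
  cone-clique singleton F clique (suc (suc v)) (suc zero) _ (there ()) _

  banner-suspension : ∀ i → IsBanner i Δ → IsBanner (suc i) (Suspension Δ)
  banner-suspension i banner (bu ∷ bu' ∷ F) clique critical size =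
    old-part-face , one-apex
    where
    one-apex : AtMostOneApex bu bu'
    one-apex = clique-at-most-one-apex bu bu' F clique

    large : suc i ≤ ∣ F ∣
    large with ≤-trans size (size-at-most-one-apex bu bu' F one-apex)
    ... | s≤s large = large

    old-part-face : Δ F
    old-part-face =
      [ (λ face → face)
      , (λ F-critical → banner F (clique-restrict bu bu' F clique) F-critical large)
      ] (critical-restrict bu bu' F critical)

  -- (⇐) A critical clique of Δ with ≥ i+1 vertices is a face: its cone is one in ΣΔ.
  banner-desuspension : (∀ v → Δ ⁅ v ⁆) → ∀ i →
    IsBanner (suc i) (Suspension Δ) → IsBanner i Δ
  banner-desuspension singleton i banner F clique critical size =
    proj₁ (banner (true ∷ false ∷ F) (cone-clique singleton F clique)
                  (cone-critical F critical) (s≤s size))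

-- Both directions hold for every i.
lemma3p5 : {n : ℕ} (Δ : Family n) → IsSimplicialComplex Δ → (i : ℕ) → 1 ≤ i →
    (IsBanner i Δ → IsBanner (suc i) (Suspension Δ)) × (IsBanner (suc i) (Suspension Δ) → IsBanner i Δ)
lemma3p5 Δ complex i _ =
  banner-suspension Δ i , banner-desuspension Δ (IsSimplicialComplex.singletons complex) i
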